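{- Let $U$ be a non-empty finite set. Consider the set of pairs $(T,F)$, where $T$ is a labeled rooted tree on $U$ and $F$ is a subforest of $T$, and the set of triples $(F,\hat T,\phi)$, where $F$ is a forest of labeled rooted trees on $U$ with set partition $\Gamma$, $\hat T$ is a labeled rooted tree on the vertex set $\Gamma$ with some root $U_0\in\Gamma$, and $\phi$ is a function on $\Gamma_1=\Gamma\setminus\{U_0\}$ with $\phi(B)\in\hat T(B)$ for every $B\in\Gamma_1$. The map sending $(T,F)$ to $(F, T/F, \phi)$, where $\phi(B)=T(\rho_B)$ for the root $\rho_B$ of the tree of $F$ on block $B$, is a one-to-one correspondence between these two sets.
   Context: A labeled rooted tree on a non-empty finite set $U$ consists of a root $r\in U$ and a function $T:U\setminus\{r\}\to U$ such that no non-empty $S\subseteq U\setminus\{r\}$ satisfies $T(S)\subseteq S$. A forest of labeled rooted trees on $V$ is a subset $R\subseteq V$ of roots and a function $F:V\setminus R\to V$ such that no non-empty $S\subseteq V\setminus R$ satisfies $F(S)\subseteq S$; its set partition $\Gamma$ has, for each $\rho\in R$, the block $\{k: F^m(k)=\rho \text{ for some } m\ge0\}$, and $F$ restricted to each block is a rooted tree with root $\rho$. Given a labeled rooted tree $T$ on $U$ with root $r$ and a set $R$ with $r\in R\subseteq U$, the restriction of $T$ to $U\setminus R$ is a forest on $U$ with root set $R$, called a subforest of $T$ (written $F\sqsubseteq T$). Let $U_0$ be the block of $\Gamma$ containing $r$. The quotient rooted tree $T/F$ is the labeled rooted tree on vertex set $\Gamma$ with root $U_0$, defined on $\Gamma\setminus\{U_0\}$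 by sending a block $B$ with root $\rho_B$ to the block containing $T(\rho_B)$. -}

module Defs where

open import Data.Nat using (ℕ; zero; suc)
open import Data.Bool using (Bool; true; false)
open import Data.Maybe using (Maybe; just; nothing; _>>=_)
open import Data.Product using (Σ; ∃; ∃-syntax; _×_; _,_; proj₁)
open import Data.Sum using (_⊎_)
open import Relation.Nullary using (¬_)
open import Relation.Binary.PropositionalEquality using (_≡_; _≢_)

-- A partial map A ⇀ A (the paper's F : V ∖ R → V) is encoded as
-- f : A → Maybe A ; f a ≡ nothing  iff  a is a root (a ∈ R).
-- A subset S of a finite set is a characteristic function A → Bool.

Closed : {A : Set} → (A → Maybe A) → (A → Bool) → Set
Closed f S = ∀ a → S a ≡ true → ∃[ b ] (f a ≡ just b × S b ≡ true)

Acyclic : {A : Set} → (A → Maybe A) → Set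
Acyclic f = ∀ S → Closed f S → ¬ (∃[ a ] S a ≡ true)

record Forest (V : Set) : Set where
  field
    par     : V → Maybe V
    acyclic : Acyclic par
open Forest public

record Tree (U : Set) : Set where
  field
    root      : U
    tpar      : U → Maybe U
    root-dom  : tpar root ≡ nothing
    dom-root  : ∀ u → tpar u ≡ nothing → u ≡ root
    tacyclic  : Acyclic tpar
open Tree public

iter : {A : Set} → (A → Maybe A) → ℕ → A → Maybe A
iter f zero    a = just a
iter f (suc m) a = iter f m a >>= f

-- The set partition Γ of a forest: one block per root ρ;
-- a block is represented by (its root ρ, proof that ρ ∈ R).
Block : {V : Set} → Forest V → Set
Block {V} F = Σ V (λ ρ → par F ρ ≡ nothing)

InBlock : {V : Set} (F : Forest V) → Block F → V → Set
InBlock F (ρ , _) k = ∃[ m ] iter (par F) m k ≡ just ρ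

-- F ⊑ T : F is the restriction of T to U ∖ R for some R with r ∈ R ⊆ U
-- (and R is then the root set of F).
_⊑_ : {U : Set} → Forest U → Tree U → Set
_⊑_ {U} F T = Σ (U → Bool) λ R → (R (root T) ≡ true ×
  (∀ k → (R k ≡ true → par F k ≡ nothing) × (R k ≡ false → par F k ≡ tpar T k)))

-- T̂ is the quotient T / F : root is the block U₀ containing r, and each
-- block B ≠ U₀ with root ρ_B is sent to the block containing T(ρ_B).
IsQuotient : {U : Set} (T : Tree U) (F : Forest U) → Tree (Block F) → Set
IsQuotient T F T̂ =
  InBlock F (root T̂) (root T) ×
  (∀ B → B ≢ root T̂ → ∃[ w ] ∃[ B' ]
     (tpar T (proj₁ B) ≡ just w × tpar T̂ B ≡ just B' × InBlock F B' w))

Phi : {U : Set} (F : Forest U) → Tree (Block F) → Set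
Phi {U} F T̂ = (B : Block F) → B ≢ root T̂ → U

ValidPhi : {U : Set} (F : Forest U) (T̂ : Tree (Block F)) → Phi F T̂ → Set
ValidPhi F T̂ φ = ∀ B (h : B ≢ root T̂) → ∃[ B' ] (tpar T̂ B ≡ just B' × InBlock F B' (φ B h))

PhiOf : {U : Set} (T : Tree U) (F : Forest U) (T̂ : Tree (Block F)) → Phi F T̂ → Set
PhiOf T F T̂ φ = ∀ B (h : B ≢ root T̂) → tpar T (proj₁ B) ≡ just (φ B h)

Image : {U : Set} (T : Tree U) (F : Forest U) (T̂ : Tree (Block F)) → Phi F T̂ → Set
Image T F T̂ φ = IsQuotient T F T̂ × PhiOf T F T̂ φ

_≈T_ : {U : Set} → Tree U → Tree U → Set
T ≈T T' = root T ≡ root T' × (∀ u → tpar T u ≡ tpar T' u)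

-- Following F from any vertex must stop at a root: the domains of the iterates F^j form a
-- decreasing chain of subsets of a finite set, and once the chain stops shrinking that domain
-- is F-closed, hence empty by acyclicity. So every vertex lies in exactly one block.
-- A tree T ⊒ F agrees with F off the roots of F, so T is determined by F, its root and its
-- values φ on the remaining block roots; and T/F records exactly the blocks of those values.
-- Acyclicity transfers both ways: a T/F-closed set of blocks pulls back to a T-closed set of
-- vertices, and a T-closed set is closed along F, so its blocks form a T/F-closed set.
module Submission where

open import Defs
open import Data.Nat using (ℕ; suc)
open import Data.Fin using (Fin)
open import Data.Product using (Σ; ∃; ∃-syntax; _×_; _,_)
open import Relation.Binary.PropositionalEquality using (_≡_)

open import Axiom.UniquenessOfIdentityProofs.WithK using (uip)
open import Data.Bool using (Bool; true; false)
open import Data.Empty using (⊥-elim)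
open import Data.Fin.Properties using () renaming (_≟_ to _≟ᶠ_)
open import Data.Fin.Subset using (Subset; _∈_; _⊆_; _⊂_; ∣_∣)
open import Data.Fin.Subset.Properties using (_∈?_; _⊂?_; p⊂q⇒∣p∣<∣q∣; ∣p∣≤n)
open import Data.Maybe using (Maybe; just; nothing; _>>=_; is-just; is-nothing)
open import Data.Maybe.Properties using (just-injective)
open import Data.Nat using (zero; _+_; _≤_)
open import Data.Nat.Properties using (≤-trans; +-suc; +-monoʳ-≤; m≤m+n; n≮n; module ≤-Reasoning)
open import Data.Product using (proj₁; proj₂)
open import Data.Sum using (_⊎_; inj₁; inj₂)
open import Data.Vec using (tabulate)
open import Data.Vec.Properties using (lookup∘tabulate; lookup⇒[]=; []=⇒lookup)
open import Function using (_∘_)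
open import Relation.Binary.Definitions using (DecidableEquality)
open import Relation.Binary.PropositionalEquality using (_≢_; refl; sym; trans; cong; subst)
open import Relation.Nullary using (Dec; yes; no; contradiction; map′)

iter-suc : {A : Set} (f : A → Maybe A) (m : ℕ) (a : A) → iter f (suc m) a ≡ (f a >>= iter f m)
iter-suc f zero    a with f a
... | just _  = refl
... | nothing = refl
iter-suc f (suc m) a rewrite iter-suc f m a with f a
... | just _  = refl
... | nothing = refl

iter-root-unique : {A : Set} (f : A → Maybe A) {a ρ ρ' : A} (m m' : ℕ) →
  iter f m a ≡ just ρ → f ρ ≡ nothing → iter f m' a ≡ just ρ' → f ρ' ≡ nothing → ρ ≡ ρ'
iter-root-unique f zero zero refl _ refl _ = refl
iter-root-unique f {a} zero (suc m') refl fa e' _ rewrite iter-suc f m' a | fa with e'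
... | ()
iter-root-unique f {a} (suc m) zero e _ refl fa rewrite iter-suc f m a | fa with e
... | ()
iter-root-unique f {a} (suc m) (suc m') e fρ e' fρ' rewrite iter-suc f m a | iter-suc f m' a with f a
... | just b  = iter-root-unique f m m' e fρ e' fρ'
... | nothing with e
...   | ()

closed-along-iter : {A : Set} {f g : A → Maybe A} {S : A → Bool} →
  (∀ {a b} → f a ≡ just b → g a ≡ just b) → Closed g S →
  ∀ m {a b} → S a ≡ true → iter f m a ≡ just b → S b ≡ true
closed-along-iter ext cl zero    sa refl = sa
closed-along-iter {f = f} ext cl (suc m) {a} sa e with iter f m a in eq
... | just c with cl c (closed-along-iter ext cl m sa eq)
...   | _ , gc , sd with trans (sym (ext e)) gc
...     | refl = sd

module _ {m : ℕ} (f : Fin m → Maybe (Fin m)) (f-acyclic : Acyclic f) where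

  private
    domain : ℕ → Subset m
    domain j = tabulate (λ k → is-just (iter f j k))

    ∈-domain⁺ : ∀ j {k} → is-just (iter f j k) ≡ true → k ∈ domain j
    ∈-domain⁺ j {k} h = lookup⇒[]= k (domain j) (trans (lookup∘tabulate _ k) h)

    ∈-domain⁻ : ∀ j {k} → k ∈ domain j → is-just (iter f j k) ≡ true
    ∈-domain⁻ j {k} h = trans (sym (lookup∘tabulate _ k)) ([]=⇒lookup h)

    is-just-bind : (x : Maybe (Fin m)) → is-just (x >>= f) ≡ true → is-just x ≡ true
    is-just-bind (just _) _ = refl

    domain-suc-⊆ : ∀ j → domain (suc j) ⊆ domain j
    domain-suc-⊆ j {k} h = ∈-domain⁺ j (is-just-bind (iter f j k) (∈-domain⁻ (suc j) h))

    stable-domain-closed : ∀ j → domain j ⊆ domain (suc j) → Closed f (λ k → is-just (iter f j k))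
    stable-domain-closed j stable a ha with f a in fa | a∈domain-suc
      where
        a∈domain-suc : is-just (f a >>= iter f j) ≡ true
        a∈domain-suc =
          subst (λ x → is-just x ≡ true) (iter-suc f j a) (∈-domain⁻ (suc j) (stable (∈-domain⁺ j ha)))
    ... | just b | hb = b , refl , hb

    shrinks-or-vanishes : ∀ j → domain (suc j) ⊂ domain j ⊎ (∀ k → iter f j k ≡ nothing)
    shrinks-or-vanishes j with domain (suc j) ⊂? domain j
    ... | yes shrinks = inj₁ shrinks
    ... | no ¬shrinks = inj₂ vanishes
      where
        stable : domain j ⊆ domain (suc j)
        stable {k} k∈ with k ∈? domain (suc j)
        ... | yes k∈′ = k∈′
        ... | no k∉′  = contradiction ((λ {x} → domain-suc-⊆ j {x}) , k , k∈ , k∉′) ¬shrinks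
        vanishes : ∀ k → iter f j k ≡ nothing
        vanishes k with iter f j k in eq
        ... | nothing = refl
        ... | just _  = ⊥-elim (f-acyclic _ (stable-domain-closed j stable) (k , cong is-just eq))

    vanishes-or-bounded : ∀ j → (∀ k → iter f j k ≡ nothing) ⊎ j + ∣ domain j ∣ ≤ m
    vanishes-or-bounded zero = inj₂ (∣p∣≤n (domain zero))
    vanishes-or-bounded (suc j) with vanishes-or-bounded j | shrinks-or-vanishes j
    ... | inj₁ vanishes | _            = inj₁ (λ k → cong (_>>= f) (vanishes k))
    ... | inj₂ _        | inj₂ vanishes = inj₁ (λ k → cong (_>>= f) (vanishes k))
    ... | inj₂ bounded  | inj₁ shrinks = inj₂ (begin
      suc j + ∣ domain (suc j) ∣ ≡⟨ +-suc j _ ⟨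
      j + suc ∣ domain (suc j) ∣ ≤⟨ +-monoʳ-≤ j (p⊂q⇒∣p∣<∣q∣ shrinks) ⟩
      j + ∣ domain j ∣           ≤⟨ bounded ⟩
      m                          ∎)
      where open ≤-Reasoning

  iter-vanishes : ∀ k → iter f (suc m) k ≡ nothing
  iter-vanishes with vanishes-or-bounded (suc m)
  ... | inj₁ vanishes = vanishes
  ... | inj₂ bounded  = contradiction (≤-trans (m≤m+n (suc m) _) bounded) (n≮n m)

⊑-root : {V : Set} (F : Forest V) (T : Tree V) → F ⊑ T → par F (root T) ≡ nothing
⊑-root F T (_ , r∈R , agree) = proj₁ (agree _) r∈R

⊑-par : {V : Set} (F : Forest V) (T : Tree V) → F ⊑ T → ∀ {k b} → par F k ≡ just b → tpar T k ≡ just b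
⊑-par F T (R , _ , agree) {k} Fk with R k in Rk
... | true  = contradiction (trans (sym (proj₁ (agree k) Rk)) Fk) λ ()
... | false = trans (sym (proj₂ (agree k) Rk)) Fk

ValidPhi∧PhiOf⇒IsQuotient : {V : Set} (F : Forest V) (T : Tree V) (T̂ : Tree (Block F)) (φ : Phi F T̂) →
  InBlock F (root T̂) (root T) → PhiOf T F T̂ φ → ValidPhi F T̂ φ → IsQuotient T F T̂
ValidPhi∧PhiOf⇒IsQuotient F T T̂ φ r∈ φ-parent valid =
  r∈ , λ B h → φ B h , proj₁ (valid B h) , φ-parent B h , proj₂ (valid B h)

module Correspondence {V : Set} (_≟_ : DecidableEquality V) (F : Forest V)
         (reaches-root : ∀ k → ∃[ m ] iter (par F) m k ≡ nothing) where

  block-≡ : {B B' : Block F} → proj₁ B ≡ proj₁ B' → B ≡ B'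
  block-≡ {_ , p} {_ , q} refl = cong (_ ,_) (uip p q)

  _≟ᴮ_ : DecidableEquality (Block F)
  B ≟ᴮ B' = map′ block-≡ (cong proj₁) (proj₁ B ≟ proj₁ B')

  InBlock-unique : ∀ {B B' k} → InBlock F B k → InBlock F B' k → B ≡ B'
  InBlock-unique {_ , p} {_ , p'} (m , e) (m' , e') = block-≡ (iter-root-unique (par F) m m' e p e' p')

  InBlock-step : ∀ {B k b} → par F k ≡ just b → InBlock F B b → InBlock F B k
  InBlock-step {k = k} Fk (m , e) =
    suc m , trans (iter-suc (par F) m k) (trans (cong (_>>= iter (par F) m) Fk) e)

  vanishing⇒containingBlock : ∀ {k} j → iter (par F) j k ≡ nothing → Σ (Block F) λ B → InBlock F B k
  vanishing⇒containingBlock {k} (suc j) e with iter (par F) j k in eq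
  ... | nothing = vanishing⇒containingBlock j eq
  ... | just ρ  = (ρ , e) , j , eq

  containingBlock : ∀ k → Σ (Block F) λ B → InBlock F B k
  containingBlock k = vanishing⇒containingBlock (proj₁ (reaches-root k)) (proj₂ (reaches-root k))

  blockOf : V → Block F
  blockOf k = proj₁ (containingBlock k)

  ∈-blockOf : ∀ k → InBlock F (blockOf k) k
  ∈-blockOf k = proj₂ (containingBlock k)

  blockOf-root : (B : Block F) → blockOf (proj₁ B) ≡ B
  blockOf-root B = InBlock-unique (∈-blockOf (proj₁ B)) (0 , refl)

  blockOf-step : ∀ {k b} → par F k ≡ just b → blockOf b ≡ blockOf k
  blockOf-step {k} {b} Fk = InBlock-unique (InBlock-step {B = blockOf b} Fk (∈-blockOf b)) (∈-blockOf k)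

  blockParent : Tree V → Block F → Maybe (Block F)
  blockParent T B = tpar T (proj₁ B) >>= just ∘ blockOf

  blockParent-just : ∀ T {B B'} → blockParent T B ≡ just B' →
    ∃[ w ] (tpar T (proj₁ B) ≡ just w × blockOf w ≡ B')
  blockParent-just T {B} e with tpar T (proj₁ B)
  ... | just w = w , refl , just-injective e

  module Quotient (T : Tree V) (F⊑T : F ⊑ T) where

    rootBlock : Block F
    rootBlock = root T , ⊑-root F T F⊑T

    blockParent-nothing : ∀ B → blockParent T B ≡ nothing → B ≡ rootBlock
    blockParent-nothing B e with tpar T (proj₁ B) in eq
    ... | nothing = block-≡ (dom-root T _ eq)

    closed-pullback : ∀ {Ŝ} → Closed (blockParent T) Ŝ → Closed (tpar T) (Ŝ ∘ blockOf)
    closed-pullback {Ŝ} cl k k∈S with par F k in Fk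
    ... | just b = b , ⊑-par F T F⊑T Fk , subst (λ B → Ŝ B ≡ true) (sym (blockOf-step Fk)) k∈S
    ... | nothing with cl (k , Fk) (subst (λ B → Ŝ B ≡ true) (blockOf-root (k , Fk)) k∈S)
    ...   | B' , TB≡B' , B'∈Ŝ with blockParent-just T {B = k , Fk} TB≡B'
    ...     | w , Tk≡w , w∈B' = w , Tk≡w , subst (λ B → Ŝ B ≡ true) (sym w∈B') B'∈Ŝ

    quotient : Tree (Block F)
    quotient = record
      { root     = rootBlock
      ; tpar     = blockParent T
      ; root-dom = cong (_>>= just ∘ blockOf) (root-dom T)
      ; dom-root = blockParent-nothing
      ; tacyclic = λ Ŝ cl (B , B∈Ŝ) →
          tacyclic T (Ŝ ∘ blockOf) (closed-pullback cl)
            (proj₁ B , subst (λ B → Ŝ B ≡ true) (sym (blockOf-root B)) B∈Ŝ)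
      }

    parent : (B : Block F) → B ≢ rootBlock → ∃[ w ] tpar T (proj₁ B) ≡ just w
    parent B B≢r with tpar T (proj₁ B) in eq
    ... | just w  = w , refl
    ... | nothing = contradiction (block-≡ (dom-root T _ eq)) B≢r

    φ : Phi F quotient
    φ B h = proj₁ (parent B h)

    φ-parent : PhiOf T F quotient φ
    φ-parent B h = proj₂ (parent B h)

    φ-valid : ValidPhi F quotient φ
    φ-valid B h = blockOf (φ B h) , cong (_>>= just ∘ blockOf) (φ-parent B h) , ∈-blockOf (φ B h)

  image-exists : (T : Tree V) → F ⊑ T →
    Σ (Tree (Block F)) λ T̂ → Σ (Phi F T̂) λ φ → ValidPhi F T̂ φ × Image T F T̂ φ
  image-exists T F⊑T =
    quotient , φ , φ-valid , ValidPhi∧PhiOf⇒IsQuotient F T quotient φ (0 , refl) φ-parent φ-valid , φ-parent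
    where open Quotient T F⊑T

  IsQuotient-par : ∀ T T̂ → IsQuotient T F T̂ → ∀ B → B ≢ root T̂ → tpar T̂ B ≡ blockParent T B
  IsQuotient-par T T̂ (_ , step) B B≢r with step B B≢r
  ... | w , B' , Tρ≡w , T̂B≡B' , w∈B' rewrite Tρ≡w =
    trans T̂B≡B' (cong just (InBlock-unique {B = B'} w∈B' (∈-blockOf w)))

  image-unique : (T : Tree V) (T̂ T̂' : Tree (Block F)) (φ : Phi F T̂) (φ' : Phi F T̂') →
    Image T F T̂ φ → Image T F T̂' φ' → T̂ ≈T T̂' × (∀ B h h' → φ B h ≡ φ' B h')
  image-unique T T̂ T̂' φ φ' (q@(r∈ , _) , φ-parent) (q'@(r∈' , _) , φ'-parent) = (root≡ , par≡) , φ≡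
    where
      root≡ : root T̂ ≡ root T̂'
      root≡ = InBlock-unique {B = root T̂} {B' = root T̂'} r∈ r∈'
      par≡ : ∀ B → tpar T̂ B ≡ tpar T̂' B
      par≡ B with B ≟ᴮ root T̂
      ... | yes refl = trans (root-dom T̂) (sym (trans (cong (tpar T̂') root≡) (root-dom T̂')))
      ... | no B≢r   = trans (IsQuotient-par T T̂ q B B≢r)
                             (sym (IsQuotient-par T T̂' q' B (λ e → B≢r (trans e (sym root≡)))))
      φ≡ : ∀ B h h' → φ B h ≡ φ' B h'
      φ≡ B h h' = just-injective (trans (sym (φ-parent B h)) (φ'-parent B h'))

  ⊑-rootBlock : ∀ T B → F ⊑ T → InBlock F B (root T) → proj₁ B ≡ root T
  ⊑-rootBlock T B F⊑T r∈B =
    cong proj₁ (InBlock-unique {B = B} {B' = root T , ⊑-root F T F⊑T} r∈B (0 , refl))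

  image-injective : (T T' : Tree V) → F ⊑ T → F ⊑ T' → (T̂ : Tree (Block F)) (φ : Phi F T̂) →
    Image T F T̂ φ → Image T' F T̂ φ → T ≈T T'
  image-injective T T' F⊑T F⊑T' T̂ φ ((r∈ , _) , φ-parent) ((r∈' , _) , φ-parent') = root≡ , par≡
    where
      root≡ : root T ≡ root T'
      root≡ = trans (sym (⊑-rootBlock T (root T̂) F⊑T r∈)) (⊑-rootBlock T' (root T̂) F⊑T' r∈')
      par≡ : ∀ u → tpar T u ≡ tpar T' u
      par≡ u with par F u in Fu
      ... | just b  = trans (⊑-par F T F⊑T Fu) (sym (⊑-par F T' F⊑T' Fu))
      ... | nothing with (u , Fu) ≟ᴮ root T̂
      ...   | no u≢r     = trans (φ-parent (u , Fu) u≢r) (sym (φ-parent' (u , Fu) u≢r))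
      ...   | yes u-root =
        trans (cong (tpar T) u≡r) (trans (root-dom T) (sym (trans (cong (tpar T') u≡r') (root-dom T'))))
        where
          u≡r  = trans (cong proj₁ u-root) (⊑-rootBlock T (root T̂) F⊑T r∈)
          u≡r' = trans (cong proj₁ u-root) (⊑-rootBlock T' (root T̂) F⊑T' r∈')

  module Lift (T̂ : Tree (Block F)) (φ : Phi F T̂) (valid : ValidPhi F T̂ φ) where

    rootParent : (B : Block F) → Dec (B ≡ root T̂) → Maybe V
    rootParent B (yes _)  = nothing
    rootParent B (no B≢r) = just (φ B B≢r)

    rootParent-root : ∀ d → rootParent (root T̂) d ≡ nothing
    rootParent-root (yes _)  = refl
    rootParent-root (no r≢r) = contradiction refl r≢r

    rootParent-nothing : ∀ B d → rootParent B d ≡ nothing → B ≡ root T̂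
    rootParent-nothing B (yes B≡r) _ = B≡r

    rootParent-φ : ∀ B (B≢r : B ≢ root T̂) d → rootParent B d ≡ just (φ B B≢r)
    rootParent-φ B B≢r (yes B≡r) = contradiction B≡r B≢r
    rootParent-φ B B≢r (no _)    = refl  -- proofs of ¬ are definitionally equal, as ⊥ is irrelevant

    -- Taking the value of par F u as an argument, with its equation, lets the nothing-clause
    -- form the block (u , Fu) while leaving par F u itself free for later case analysis.
    liftPar′ : (u : V) (m : Maybe V) → par F u ≡ m → Maybe V
    liftPar′ u (just v) _  = just v
    liftPar′ u nothing  Fu = rootParent (u , Fu) ((u , Fu) ≟ᴮ root T̂)

    liftPar : V → Maybe V
    liftPar u = liftPar′ u (par F u) refl

    liftPar-par : ∀ {u v} → par F u ≡ just v → liftPar u ≡ just v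
    liftPar-par {u} = go (par F u) refl
      where
        go : ∀ {v} m (Fu : par F u ≡ m) → m ≡ just v → liftPar′ u m Fu ≡ just v
        go _ _ refl = refl

    liftPar-block : ∀ B → liftPar (proj₁ B) ≡ rootParent B (B ≟ᴮ root T̂)
    liftPar-block (ρ , Fρ) = go (par F ρ) refl Fρ
      where
        go : ∀ m (Fρ′ : par F ρ ≡ m) → m ≡ nothing → liftPar′ ρ m Fρ′ ≡ rootParent (ρ , Fρ) ((ρ , Fρ) ≟ᴮ root T̂)
        go _ Fρ′ refl rewrite uip Fρ′ Fρ = refl

    liftPar-root : liftPar (proj₁ (root T̂)) ≡ nothing
    liftPar-root = trans (liftPar-block (root T̂)) (rootParent-root _)

    liftPar-φ : ∀ B (B≢r : B ≢ root T̂) → liftPar (proj₁ B) ≡ just (φ B B≢r)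
    liftPar-φ B B≢r = trans (liftPar-block B) (rootParent-φ B B≢r _)

    liftPar-dom : ∀ u → liftPar u ≡ nothing → u ≡ proj₁ (root T̂)
    liftPar-dom u = go (par F u) refl
      where
        go : ∀ m (Fu : par F u ≡ m) → liftPar′ u m Fu ≡ nothing → u ≡ proj₁ (root T̂)
        go nothing Fu e = cong proj₁ (rootParent-nothing (u , Fu) _ e)

    liftPar-acyclic : Acyclic liftPar
    liftPar-acyclic S cl (a , a∈S) = acyclic F S closedF (a , a∈S)
      where
        closedQ : Closed (tpar T̂) (S ∘ proj₁)
        closedQ B B∈S with B ≟ᴮ root T̂ | cl (proj₁ B) B∈S
        ... | yes refl | _ , lift-r≡b , _ = contradiction (trans (sym lift-r≡b) liftPar-root) λ ()
        ... | no B≢r   | b , lift-B≡b , b∈S with trans (sym lift-B≡b) (liftPar-φ B B≢r)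
        ...   | refl with valid B B≢r
        ...     | B' , T̂B≡B' , (m , φ↝B') = B' , T̂B≡B' , closed-along-iter liftPar-par cl m b∈S φ↝B'
        closedF : Closed (par F) S
        closedF k k∈S = go (par F k) refl
          where
            go : ∀ m → par F k ≡ m → ∃[ b ] (par F k ≡ just b × S b ≡ true)
            go nothing Fk = ⊥-elim (tacyclic T̂ (S ∘ proj₁) closedQ ((k , Fk) , k∈S))
            go (just b) Fk with cl k k∈S
            ... | d , lift-k≡d , d∈S with trans (sym (liftPar-par Fk)) lift-k≡d
            ...   | refl = b , Fk , d∈S

    lift : Tree V
    lift = record
      { root     = proj₁ (root T̂)
      ; tpar     = liftPar
      ; root-dom = liftPar-root
      ; dom-root = liftPar-dom
      ; tacyclic = liftPar-acyclic
      }

    F⊑lift : F ⊑ lift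
    F⊑lift = (λ k → is-nothing (par F k)) , cong is-nothing (proj₂ (root T̂)) , λ k → agree k (par F k) refl
      where
        agree : ∀ k m → par F k ≡ m → (is-nothing m ≡ true → m ≡ nothing) × (is-nothing m ≡ false → m ≡ liftPar k)
        agree k nothing  _  = (λ _ → refl) , λ ()
        agree k (just v) Fk = (λ ()) , λ _ → sym (liftPar-par Fk)

  image-surjective : (T̂ : Tree (Block F)) (φ : Phi F T̂) → ValidPhi F T̂ φ → ∃[ T ] (F ⊑ T × Image T F T̂ φ)
  image-surjective T̂ φ valid =
    lift , F⊑lift , ValidPhi∧PhiOf⇒IsQuotient F lift T̂ φ (0 , refl) liftPar-φ valid , liftPar-φ
    where open Lift T̂ φ valid

mainTheorem12 : (n : ℕ) (F : Forest (Fin (suc n))) →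
    ((T : Tree (Fin (suc n))) → F ⊑ T →
       Σ (Tree (Block F)) λ T̂ → Σ (Phi F T̂) λ φ → ValidPhi F T̂ φ × Image T F T̂ φ)
    × ((T : Tree (Fin (suc n))) → F ⊑ T → (T̂ T̂' : Tree (Block F)) (φ : Phi F T̂) (φ' : Phi F T̂') →
       Image T F T̂ φ → Image T F T̂' φ' →
       T̂ ≈T T̂' × (∀ B h h' → φ B h ≡ φ' B h'))
    × ((T T' : Tree (Fin (suc n))) → F ⊑ T → F ⊑ T' → (T̂ : Tree (Block F)) (φ : Phi F T̂) →
       Image T F T̂ φ → Image T' F T̂ φ → T ≈T T')
    × ((T̂ : Tree (Block F)) (φ : Phi F T̂) → ValidPhi F T̂ φ →
       ∃[ T ] (F ⊑ T × Image T F T̂ φ))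
mainTheorem12 n F = image-exists , (λ T _ → image-unique T) , image-injective , image-surjective
  where open Correspondence _≟ᶠ_ F (λ k → suc (suc n) , iter-vanishes (par F) (acyclic F) k)
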